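{- For every positive integer $n$, the graph $\Phi(\mathbb H(\mathbb Z_{2^n}))$ is connected, its diameter equals $2$, and its radius equals $1$.
   Context: For a positive integer $m$, $\mathbb Z_m$ denotes the integers modulo $m$, and $\mathbb H(\mathbb Z_m)$ denotes the ring of Hamilton quaternions over $\mathbb Z_m$: its elements are $a_1+a_2i+a_3j+a_4k$ with $a_1,a_2,a_3,a_4\in\mathbb Z_m$, written $(a_1,a_2,a_3,a_4)$. Addition is coordinatewise, and multiplication is determined by distributivity, scalars commuting with $i,j,k$, and $i^2=j^2=k^2=-1$, $ij=-ji=k$, $jk=-kj=i$, $ki=-ik=j$. Explicitly, $(a_1,a_2,a_3,a_4)(b_1,b_2,b_3,b_4)=(a_1b_1-a_2b_2-a_3b_3-a_4b_4,\ a_2b_1+a_1b_2-a_4b_3+a_3b_4,\ a_3b_1+a_4b_2+a_1b_3-a_2b_4,\ a_4b_1-a_3b_2+a_2b_3+a_1b_4)$. For a ring $R$ with unity, the non-zero divisor graph $\Phi(R)$ is the simple graph with vertex set $R\setminus\{0,1,-1\}$ in which two distinct vertices $x,y$ are adjacent if and only if $xy\neq 0$ or $yx\neq 0$. -}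

module Defs where

open import Data.Nat using (ℕ; zero; suc; _≤_; _<_; _^_; NonZero)
open import Data.Nat.DivMod using (_%_)
open import Data.Fin using (Fin; toℕ; fromℕ<)
open import Data.Nat.DivMod using (m%n<n)
open import Data.Product using (Σ; ∃; ∃-syntax; _×_; _,_)
open import Data.Sum using (_⊎_)
open import Relation.Nullary using (¬_)
open import Relation.Binary.PropositionalEquality using (_≡_)

module ZMod (m : ℕ) .{{_ : NonZero m}} where

  Zm : Set
  Zm = Fin m

  fromNat : ℕ → Zm
  fromNat a = fromℕ< (m%n<n a m)

  infixl 6 _+m_ _-m_
  infixl 7 _*m_

  _+m_ : Zm → Zm → Zm
  a +m b = fromNat (toℕ a Data.Nat.+ toℕ b)

  _*m_ : Zm → Zm → Zm
  a *m b = fromNat (toℕ a Data.Nat.* toℕ b)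

  -m_ : Zm → Zm
  -m a = fromNat (m Data.Nat.∸ toℕ a)

  _-m_ : Zm → Zm → Zm
  a -m b = a +m (-m b)

  0m 1m : Zm
  0m = fromNat 0
  1m = fromNat 1

  -- Hamilton quaternions ℍ(ℤ_m): a1 + a2 i + a3 j + a4 k

  record ℍ : Set where
    constructor quat
    field
      a1 a2 a3 a4 : Zm

  0ℍ 1ℍ -1ℍ : ℍ
  0ℍ  = quat 0m 0m 0m 0m
  1ℍ  = quat 1m 0m 0m 0m
  -1ℍ = quat (-m 1m) 0m 0m 0m

  _·_ : ℍ → ℍ → ℍ
  quat a1 a2 a3 a4 · quat b1 b2 b3 b4 =
    quat (a1 *m b1 -m a2 *m b2 -m a3 *m b3 -m a4 *m b4)
         (a2 *m b1 +m a1 *m b2 -m a4 *m b3 +m a3 *m b4)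
         (a3 *m b1 +m a4 *m b2 +m a1 *m b3 -m a2 *m b4)
         (a4 *m b1 -m a3 *m b2 +m a2 *m b3 +m a1 *m b4)

  IsVertex : ℍ → Set
  IsVertex x = ¬ x ≡ 0ℍ × ¬ x ≡ 1ℍ × ¬ x ≡ -1ℍ

  Vertex : Set
  Vertex = Σ ℍ IsVertex

  vtx : Vertex → ℍ
  vtx (x , _) = x

  Adj : Vertex → Vertex → Set
  Adj u v = ¬ vtx u ≡ vtx v × (¬ (vtx u · vtx v) ≡ 0ℍ ⊎ ¬ (vtx v · vtx u) ≡ 0ℍ)

module GraphNotions {V : Set} (Adj : V → V → Set) where

  data Walk : V → V → ℕ → Set where
    here : ∀ {x} → Walk x x zero
    step : ∀ {x y z k} → Adj x y → Walk y z k → Walk x z (suc k)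

  Connected : Set
  Connected = ∀ x y → ∃[ k ] Walk x y k

  Dist : V → V → ℕ → Set
  Dist x y k = Walk x y k × (∀ j → j < k → ¬ Walk x y j)

  Ecc : V → ℕ → Set
  Ecc x r = (∀ y → ∃[ k ] (Dist x y k × k ≤ r)) × (∃[ y ] Dist x y r)

  Diameter : ℕ → Set
  Diameter d = (∀ x y → ∃[ k ] (Dist x y k × k ≤ d)) × (∃[ x ] ∃[ y ] Dist x y d)

  Radius : ℕ → Set
  Radius r = (∃[ x ] Ecc x r) × (∀ x s → Ecc x s → r ≤ s)

module Submission where

-- The quaternion i is a unit, so i·y = 0 forces y = 0: i is adjacent to every other vertex,
-- which gives radius 1 and diameter at most 2. With h = 2^(n-1) we have 2h² ≡ 0 (mod 2^n),
-- and then x = h(1 + i), y = h(j + k) satisfy xy = 2h²k = 0 and yx = 2h²j = 0, so two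
-- distinct vertices are not adjacent and the diameter is exactly 2.

open import Defs
open import Data.Nat using (ℕ; zero; suc; NonZero; _≤_; _<_; _+_; _*_; _∸_; _^_; z≤n; s≤s; >-nonZero⁻¹)
open import Data.Nat.Properties
  using (m^n≢0; m^n>0; ^-monoʳ-<; n<1+n; *-identityˡ; *-zeroʳ; +-identityʳ; m+[n∸m]≡n; <⇒≤; <⇒≢)
open import Data.Nat.Solver using (module +-*-Solver)
open import Data.Nat.DivMod using (_%_; m<n⇒m%n≡m; m*n%n≡0; %-distribˡ-+; %-distribˡ-*)
open import Data.Fin using (toℕ)
open import Data.Fin.Properties using (toℕ-fromℕ<; toℕ-injective; toℕ<n) renaming (_≟_ to _≟ᶠ_)
open import Data.Product using (_×_; ∃-syntax; _,_; proj₁; proj₂)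
open import Data.Sum using (inj₁; inj₂; swap)
open import Data.Empty using (⊥-elim)
open import Function using (_∘_)
open import Relation.Nullary using (¬_; yes; no)
open import Relation.Nullary.Decidable using (¬?; _×-dec_; _⊎-dec_; map′)
open import Relation.Binary.Definitions using (Decidable; DecidableEquality; Irreflexive; Symmetric)
open import Relation.Binary.PropositionalEquality

module ZModProperties (m : ℕ) .{{_ : NonZero m}} where
  open ZMod m
  open ≡-Reasoning

  toℕ-fromNat : ∀ a → toℕ (fromNat a) ≡ a % m
  toℕ-fromNat a = toℕ-fromℕ< _

  fromNat-toℕ : ∀ x → fromNat (toℕ x) ≡ x
  fromNat-toℕ x = toℕ-injective (trans (toℕ-fromNat (toℕ x)) (m<n⇒m%n≡m (toℕ<n x)))

  fromNat-cong : ∀ {a b} → a % m ≡ b % m → fromNat a ≡ fromNat b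
  fromNat-cong {a} {b} eq = toℕ-injective (trans (toℕ-fromNat a) (trans eq (sym (toℕ-fromNat b))))

  fromNat-+ : ∀ a b → fromNat a +m fromNat b ≡ fromNat (a + b)
  fromNat-+ a b = fromNat-cong (begin
    (toℕ (fromNat a) + toℕ (fromNat b)) % m ≡⟨ cong₂ (λ x y → (x + y) % m) (toℕ-fromNat a) (toℕ-fromNat b) ⟩
    (a % m + b % m) % m                     ≡⟨ %-distribˡ-+ a b m ⟨
    (a + b) % m                             ∎)

  fromNat-* : ∀ a b → fromNat a *m fromNat b ≡ fromNat (a * b)
  fromNat-* a b = fromNat-cong (begin
    (toℕ (fromNat a) * toℕ (fromNat b)) % m ≡⟨ cong₂ (λ x y → (x * y) % m) (toℕ-fromNat a) (toℕ-fromNat b) ⟩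
    (a % m * (b % m)) % m                   ≡⟨ %-distribˡ-* a b m ⟨
    (a * b) % m                             ∎)

  fromNat-*-m : ∀ a → fromNat (a * m) ≡ 0m
  fromNat-*-m a = fromNat-cong (trans (m*n%n≡0 a m) (sym (m<n⇒m%n≡m (>-nonZero⁻¹ m))))

  fromNat-m : fromNat m ≡ 0m
  fromNat-m = trans (cong fromNat (sym (*-identityˡ m))) (fromNat-*-m 1)

  toℕ-0m : toℕ 0m ≡ 0
  toℕ-0m = trans (toℕ-fromNat 0) (m<n⇒m%n≡m (>-nonZero⁻¹ m))

  *m-zeroˡ : ∀ x → 0m *m x ≡ 0m
  *m-zeroˡ x = cong (λ z → fromNat (z * toℕ x)) toℕ-0m

  *m-zeroʳ : ∀ x → x *m 0m ≡ 0m
  *m-zeroʳ x = trans (cong (λ z → fromNat (toℕ x * z)) toℕ-0m) (cong fromNat (*-zeroʳ (toℕ x)))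

  *m-identityˡ : ∀ x → 1m *m x ≡ x
  *m-identityˡ x = begin
    1m *m x                      ≡⟨ cong (1m *m_) (fromNat-toℕ x) ⟨
    fromNat 1 *m fromNat (toℕ x) ≡⟨ fromNat-* 1 (toℕ x) ⟩
    fromNat (1 * toℕ x)          ≡⟨ cong fromNat (*-identityˡ (toℕ x)) ⟩
    fromNat (toℕ x)              ≡⟨ fromNat-toℕ x ⟩
    x                            ∎

  +m-identityˡ : ∀ x → 0m +m x ≡ x
  +m-identityˡ x = trans (cong (λ z → fromNat (z + toℕ x)) toℕ-0m) (fromNat-toℕ x)

  +m-identityʳ : ∀ x → x +m 0m ≡ x
  +m-identityʳ x = begin
    x +m 0m             ≡⟨ cong (λ z → fromNat (toℕ x + z)) toℕ-0m ⟩
    fromNat (toℕ x + 0) ≡⟨ cong fromNat (+-identityʳ (toℕ x)) ⟩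
    fromNat (toℕ x)     ≡⟨ fromNat-toℕ x ⟩
    x                   ∎

  +m-identityʳ-≡0 : ∀ x {z} → z ≡ 0m → x +m z ≡ x
  +m-identityʳ-≡0 x refl = +m-identityʳ x

  -m-zero : -m 0m ≡ 0m
  -m-zero = trans (cong (λ z → fromNat (m ∸ z)) toℕ-0m) fromNat-m

  -m-identityʳ-≡0 : ∀ x {z} → z ≡ 0m → x -m z ≡ x
  -m-identityʳ-≡0 x refl = trans (cong (x +m_) -m-zero) (+m-identityʳ x)

  -m-inverseʳ : ∀ x → x -m x ≡ 0m
  -m-inverseʳ x = begin
    x -m x                                 ≡⟨ cong (_-m x) (fromNat-toℕ x) ⟨
    fromNat (toℕ x) +m fromNat (m ∸ toℕ x) ≡⟨ fromNat-+ (toℕ x) (m ∸ toℕ x) ⟩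
    fromNat (toℕ x + (m ∸ toℕ x))          ≡⟨ cong fromNat (m+[n∸m]≡n (<⇒≤ (toℕ<n x))) ⟩
    fromNat m                              ≡⟨ fromNat-m ⟩
    0m                                     ∎

  fromNat≢0m : ∀ {a} → 0 < a → a < m → fromNat a ≢ 0m
  fromNat≢0m {a} 0<a a<m a≡0 = <⇒≢ 0<a (sym (begin
    a               ≡⟨ m<n⇒m%n≡m a<m ⟨
    a % m           ≡⟨ toℕ-fromNat a ⟨
    toℕ (fromNat a) ≡⟨ cong toℕ a≡0 ⟩
    toℕ 0m          ≡⟨ toℕ-0m ⟩
    0               ∎))

  -m≡0⇒≡0 : ∀ x → -m x ≡ 0m → x ≡ 0m
  -m≡0⇒≡0 x eq = begin
    x       ≡⟨ +m-identityʳ x ⟨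
    x +m 0m ≡⟨ cong (x +m_) eq ⟨
    x -m x  ≡⟨ -m-inverseʳ x ⟩
    0m      ∎

  1m≢0m : ∀ a → a ≢ 0m → 1m ≢ 0m
  1m≢0m a a≢0 1≡0 = a≢0 (begin
    a        ≡⟨ *m-identityˡ a ⟨
    1m *m a  ≡⟨ cong (_*m a) 1≡0 ⟩
    0m *m a  ≡⟨ *m-zeroˡ a ⟩
    0m       ∎)

module WalkProperties {V : Set} {Adj : V → V → Set} where
  open GraphNotions Adj

  walk-0⇒≡ : ∀ {x y} → Walk x y 0 → x ≡ y
  walk-0⇒≡ here = refl

  walk-1⇒Adj : ∀ {x y} → Walk x y 1 → Adj x y
  walk-1⇒Adj (step a here) = a

  ecc-0⇒≡ : ∀ {x} → Ecc x 0 → ∀ y → y ≡ x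
  ecc-0⇒≡ (dist≤0 , _) y with dist≤0 y
  ... | zero , (w , _) , _ = sym (walk-0⇒≡ w)

module UniversalVertex {V : Set} (Adj : V → V → Set)
  (_≟_ : DecidableEquality V) (adj? : Decidable Adj)
  (Adj-irrefl : Irreflexive _≡_ Adj) (Adj-sym : Symmetric Adj)
  (c : V) (c-universal : ∀ v → v ≢ c → Adj c v) where
  open GraphNotions Adj
  open WalkProperties

  dist-refl : ∀ x → Dist x x 0
  dist-refl x = here , λ _ ()

  dist-adj : ∀ {x y} → Adj x y → Dist x y 1
  dist-adj a = step a here , λ { zero _ w → Adj-irrefl (walk-0⇒≡ w) a ; (suc _) (s≤s ()) }

  ¬Adj⇒≢c : ∀ {x y} → x ≢ y → ¬ Adj x y → x ≢ c
  ¬Adj⇒≢c {y = y} x≢y ¬a refl = ¬a (c-universal y (x≢y ∘ sym))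

  dist-¬adj : ∀ {x y} → x ≢ y → ¬ Adj x y → Dist x y 2
  dist-¬adj {x} {y} x≢y ¬a = via-c , shorter
    where
      via-c : Walk x y 2
      via-c = step (Adj-sym (c-universal x (¬Adj⇒≢c x≢y ¬a)))
                (step (c-universal y (¬Adj⇒≢c (x≢y ∘ sym) (¬a ∘ Adj-sym))) here)
      shorter : ∀ j → j < 2 → ¬ Walk x y j
      shorter zero _ w = x≢y (walk-0⇒≡ w)
      shorter (suc zero) _ w = ¬a (walk-1⇒Adj w)
      shorter (suc (suc _)) (s≤s (s≤s ()))

  dist≤2 : ∀ x y → ∃[ k ] (Dist x y k × k ≤ 2)
  dist≤2 x y with x ≟ y | adj? x y
  ... | yes refl | _     = 0 , dist-refl x , z≤n
  ... | no _     | yes a = 1 , dist-adj a , s≤s z≤n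
  ... | no x≢y   | no ¬a = 2 , dist-¬adj x≢y ¬a , s≤s (s≤s z≤n)

  dist-c≤1 : ∀ y → ∃[ k ] (Dist c y k × k ≤ 1)
  dist-c≤1 y with c ≟ y
  ... | yes refl = 0 , dist-refl c , z≤n
  ... | no c≢y   = 1 , dist-adj (c-universal y (c≢y ∘ sym)) , s≤s z≤n

  ecc-c : ∀ {d} → d ≢ c → Ecc c 1
  ecc-c {d} d≢c = dist-c≤1 , d , dist-adj (c-universal d d≢c)

  ecc≥1 : ∀ {d} → d ≢ c → ∀ x s → Ecc x s → 1 ≤ s
  ecc≥1 d≢c x zero e = ⊥-elim (d≢c (trans (ecc-0⇒≡ e _) (sym (ecc-0⇒≡ e c))))
  ecc≥1 d≢c x (suc s) _ = s≤s z≤n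

  connected-diameter-radius : ∀ x y → x ≢ y → ¬ Adj x y → Connected × Diameter 2 × Radius 1
  connected-diameter-radius x y x≢y ¬a =
      (λ u v → let k , (w , _) , _ = dist≤2 u v in k , w)
    , (dist≤2 , x , y , dist-¬adj x≢y ¬a)
    , (c , ecc-c x≢c) , ecc≥1 x≢c
    where
      x≢c : x ≢ c
      x≢c = ¬Adj⇒≢c x≢y ¬a

module QuaternionGraph (m : ℕ) .{{_ : NonZero m}} where
  open ZMod m
  open ZModProperties m
  open GraphNotions Adj

  quat-cong : ∀ {a1 a2 a3 a4 b1 b2 b3 b4} → a1 ≡ b1 → a2 ≡ b2 → a3 ≡ b3 → a4 ≡ b4 →
              quat a1 a2 a3 a4 ≡ quat b1 b2 b3 b4
  quat-cong refl refl refl refl = refl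

  infix 4 _≟ℍ_ _≟ᵥ_

  _≟ℍ_ : DecidableEquality ℍ
  quat a1 a2 a3 a4 ≟ℍ quat b1 b2 b3 b4 =
    map′ (λ (e1 , e2 , e3 , e4) → quat-cong e1 e2 e3 e4)
         (λ e → cong ℍ.a1 e , cong ℍ.a2 e , cong ℍ.a3 e , cong ℍ.a4 e)
         (a1 ≟ᶠ b1 ×-dec a2 ≟ᶠ b2 ×-dec a3 ≟ᶠ b3 ×-dec a4 ≟ᶠ b4)

  i : ℍ
  i = quat 0m 1m 0m 0m

  i·quat : ∀ b1 b2 b3 b4 → i · quat b1 b2 b3 b4 ≡ quat (-m b2) b1 (-m b4) b3
  i·quat b1 b2 b3 b4 = quat-cong
    (trans (-m-identityʳ-≡0 _ (*m-zeroˡ b4)) (trans (-m-identityʳ-≡0 _ (*m-zeroˡ b3))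
      (trans (cong₂ _-m_ (*m-zeroˡ b1) (*m-identityˡ b2)) (+m-identityˡ (-m b2)))))
    (trans (+m-identityʳ-≡0 _ (*m-zeroˡ b4)) (trans (-m-identityʳ-≡0 _ (*m-zeroˡ b3))
      (trans (+m-identityʳ-≡0 _ (*m-zeroˡ b2)) (*m-identityˡ b1))))
    (trans (cong₂ _-m_ (trans (+m-identityʳ-≡0 _ (*m-zeroˡ b3))
                          (trans (+m-identityʳ-≡0 _ (*m-zeroˡ b2)) (*m-zeroˡ b1)))
                       (*m-identityˡ b4))
      (+m-identityˡ (-m b4)))
    (trans (+m-identityʳ-≡0 _ (*m-zeroˡ b4))
      (trans (cong₂ _+m_ (trans (-m-identityʳ-≡0 _ (*m-zeroˡ b2)) (*m-zeroˡ b1)) (*m-identityˡ b3))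
        (+m-identityˡ b3)))

  i·y≡0⇒y≡0 : ∀ y → i · y ≡ 0ℍ → y ≡ 0ℍ
  i·y≡0⇒y≡0 (quat b1 b2 b3 b4) iy≡0 = quat-cong
    (cong ℍ.a2 iy≡0′) (-m≡0⇒≡0 b2 (cong ℍ.a1 iy≡0′)) (cong ℍ.a4 iy≡0′) (-m≡0⇒≡0 b4 (cong ℍ.a3 iy≡0′))
    where
      iy≡0′ : quat (-m b2) b1 (-m b4) b3 ≡ 0ℍ
      iy≡0′ = trans (sym (i·quat b1 b2 b3 b4)) iy≡0

  a2≢0⇒IsVertex : ∀ {q} → ℍ.a2 q ≢ 0m → IsVertex q
  a2≢0⇒IsVertex a2≢0 = a2≢0 ∘ cong ℍ.a2 , a2≢0 ∘ cong ℍ.a2 , a2≢0 ∘ cong ℍ.a2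

  a3≢0⇒IsVertex : ∀ {q} → ℍ.a3 q ≢ 0m → IsVertex q
  a3≢0⇒IsVertex a3≢0 = a3≢0 ∘ cong ℍ.a3 , a3≢0 ∘ cong ℍ.a3 , a3≢0 ∘ cong ℍ.a3

  -- Proofs of IsVertex are functions into ⊥, which the standard library makes definitionally irrelevant.
  vtx-injective : ∀ {u v : Vertex} → vtx u ≡ vtx v → u ≡ v
  vtx-injective refl = refl

  _≟ᵥ_ : DecidableEquality Vertex
  u ≟ᵥ v = map′ vtx-injective (cong vtx) (vtx u ≟ℍ vtx v)

  adj? : Decidable Adj
  adj? u v = ¬? (vtx u ≟ℍ vtx v) ×-dec (¬? (vtx u · vtx v ≟ℍ 0ℍ) ⊎-dec ¬? (vtx v · vtx u ≟ℍ 0ℍ))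

  Adj-irrefl : Irreflexive _≡_ Adj
  Adj-irrefl refl (u≢u , _) = u≢u refl

  Adj-sym : Symmetric Adj
  Adj-sym (u≢v , uv≢0⊎vu≢0) = u≢v ∘ sym , swap uv≢0⊎vu≢0

  module _ (a : Zm) (a≢0 : a ≢ 0m) (a²+a²≡0 : a *m a +m a *m a ≡ 0m) where

    iᵥ : Vertex
    iᵥ = i , a2≢0⇒IsVertex (1m≢0m a a≢0)

    iᵥ-universal : ∀ v → v ≢ iᵥ → Adj iᵥ v
    iᵥ-universal v v≢i = (v≢i ∘ vtx-injective ∘ sym) , inj₁ (proj₁ (proj₂ v) ∘ i·y≡0⇒y≡0 (vtx v))

    x y : ℍ
    x = quat a a 0m 0m
    y = quat 0m 0m a a

    -- Componentwise, x·y = (0, 0, a² − a², a² + a²) and y·x = (0, 0, a² + a², a² − a²).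
    x·y≡0 : x · y ≡ 0ℍ
    x·y≡0 = quat-cong
      (trans (-m-identityʳ-≡0 _ (*m-zeroˡ a)) (trans (-m-identityʳ-≡0 _ (*m-zeroˡ a))
        (-m-inverseʳ (a *m 0m))))
      (trans (+m-identityʳ-≡0 _ (*m-zeroˡ a)) (trans (-m-identityʳ-≡0 _ (*m-zeroˡ a))
        (trans (+m-identityʳ-≡0 _ (*m-zeroʳ a)) (*m-zeroʳ a))))
      (trans (cong (λ t → t +m a *m a -m a *m a) (trans (+m-identityʳ-≡0 _ (*m-zeroˡ 0m)) (*m-zeroˡ 0m)))
        (trans (cong (_-m a *m a) (+m-identityˡ (a *m a))) (-m-inverseʳ (a *m a))))
      (trans (cong (λ t → t +m a *m a +m a *m a) (-m-inverseʳ (0m *m 0m)))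
        (trans (cong (_+m a *m a) (+m-identityˡ (a *m a))) a²+a²≡0))

    y·x≡0 : y · x ≡ 0ℍ
    y·x≡0 = quat-cong
      (trans (-m-identityʳ-≡0 _ (*m-zeroʳ a)) (trans (-m-identityʳ-≡0 _ (*m-zeroʳ a))
        (-m-inverseʳ (0m *m a))))
      (trans (+m-identityʳ-≡0 _ (*m-zeroʳ a)) (trans (-m-identityʳ-≡0 _ (*m-zeroʳ a))
        (trans (+m-identityʳ-≡0 _ (*m-zeroˡ a)) (*m-zeroˡ a))))
      (trans (-m-identityʳ-≡0 _ (*m-zeroˡ 0m))
        (trans (+m-identityʳ-≡0 (a *m a +m a *m a) (*m-zeroˡ 0m)) a²+a²≡0))
      (trans (+m-identityʳ-≡0 _ (*m-zeroˡ 0m)) (trans (+m-identityʳ-≡0 _ (*m-zeroˡ 0m))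
        (-m-inverseʳ (a *m a))))

    xᵥ yᵥ : Vertex
    xᵥ = x , a2≢0⇒IsVertex a≢0
    yᵥ = y , a3≢0⇒IsVertex a≢0

    xᵥ≢yᵥ : xᵥ ≢ yᵥ
    xᵥ≢yᵥ = a≢0 ∘ cong (ℍ.a1 ∘ vtx)

    xᵥ≁yᵥ : ¬ Adj xᵥ yᵥ
    xᵥ≁yᵥ (_ , inj₁ xy≢0) = xy≢0 x·y≡0
    xᵥ≁yᵥ (_ , inj₂ yx≢0) = yx≢0 y·x≡0

    Φ-connected-diameter-radius : Connected × Diameter 2 × Radius 1
    Φ-connected-diameter-radius =
      -- Adj unfolds, so the implicit vertices of Adj-sym cannot be inferred and are passed on.
      UniversalVertex.connected-diameter-radius Adj _≟ᵥ_ adj? Adj-irrefl (λ {u} {v} → Adj-sym {u} {v})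
        iᵥ iᵥ-universal xᵥ yᵥ xᵥ≢yᵥ xᵥ≁yᵥ

module PowerOfTwo (k : ℕ) where
  instance
    2^[1+k]≢0 : NonZero (2 ^ suc k)
    2^[1+k]≢0 = m^n≢0 2 (suc k)

  open ZMod (2 ^ suc k)
  open ZModProperties (2 ^ suc k)
  open ≡-Reasoning

  2^k : Zm
  2^k = fromNat (2 ^ k)

  2^k≢0 : 2^k ≢ 0m
  2^k≢0 = fromNat≢0m (m^n>0 2 k) (^-monoʳ-< 2 (s≤s (s≤s z≤n)) (n<1+n k))

  2^k²+2^k²≡0 : 2^k *m 2^k +m 2^k *m 2^k ≡ 0m
  2^k²+2^k²≡0 = begin
    2^k *m 2^k +m 2^k *m 2^k                           ≡⟨ cong₂ _+m_ (fromNat-* (2 ^ k) (2 ^ k))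
                                                                      (fromNat-* (2 ^ k) (2 ^ k)) ⟩
    fromNat (2 ^ k * 2 ^ k) +m fromNat (2 ^ k * 2 ^ k) ≡⟨ fromNat-+ (2 ^ k * 2 ^ k) (2 ^ k * 2 ^ k) ⟩
    fromNat (2 ^ k * 2 ^ k + 2 ^ k * 2 ^ k)            ≡⟨ cong fromNat double-square ⟩
    fromNat (2 ^ k * 2 ^ suc k)                        ≡⟨ fromNat-*-m (2 ^ k) ⟩
    0m                                                 ∎
    where
      open +-*-Solver
      double-square : 2 ^ k * 2 ^ k + 2 ^ k * 2 ^ k ≡ 2 ^ k * 2 ^ suc k
      double-square = solve 1 (λ t → t :* t :+ t :* t := t :* (con 2 :* t)) refl (2 ^ k)

theorem4p2 : (n : ℕ) → 1 ≤ n →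
    let open ZMod (2 ^ n) {{m^n≢0 2 n}} in let open GraphNotions Adj in
      Connected × Diameter 2 × Radius 1
theorem4p2 (suc k) _ =
  QuaternionGraph.Φ-connected-diameter-radius (2 ^ suc k) 2^k 2^k≢0 2^k²+2^k²≡0
  where open PowerOfTwo k
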